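{- Let $n\ge5$ be odd, $T=\langle n,3n-2,3n-1\rangle$, $\mathrm F(T)=\max(\mathbb Z\setminus T)$ and $S=T\cup\{\mathrm F(T)\}=\langle n,3n-2,3n-1,\mathrm F(T)\rangle$. Let $L\subseteq\mathbb N^3$ be an \textsf{L}-shape associated with $S$, let $i\in\{3,\dots,\frac{n-1}{2}\}$, and let $\mathbf s_i=\frac{3n-5}{2}n+(i-2)(3n-2)+(3n-1)$. Then $L\cap\mathsf Z(\mathbf s_i)\subseteq\left\{\left(\frac{3n-5}{2},i-2,1\right),\ \left(0,\frac{n-3}{2}+i,0\right),\ \left(\frac{3n-5}{2}-3(i-2),0,2(i-2)+1\right)\right\}$.
   Context: For $m\in S\setminus\{0\}$, $\mathrm{Ap}(S,m)=\{s\in S: s-m\notin S\}$. For $s\in T$, $\mathsf Z(s)=\{(x,y,z)\in\mathbb N^3: xn+y(3n-2)+z(3n-1)=s\}$. A set $L\subseteq\mathbb N^3$ is an \textsf{L}-shape associated with $S$ if (C1) the map $(x,y,z)\mapsto xn+y(3n-2)+z(3n-1)$ is a bijection from $L$ onto $\mathrm{Ap}(S,\mathrm F(T))$, and (C2) whenever $u\in L$ and $v\in\mathbb N^3$ with $v\le u$ componentwise, then $v\in L$. -}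

module Defs where

open import Data.Nat using (ℕ; _+_; _*_; _∸_; _≤_; _<_)
open import Data.Product using (Σ; _×_; _,_; ∃-syntax)
open import Data.Sum using (_⊎_)
open import Relation.Nullary using (¬_)
open import Relation.Binary.PropositionalEquality using (_≡_)

ℕ³ : Set
ℕ³ = ℕ × ℕ × ℕ

ev : ℕ → ℕ³ → ℕ
ev n (x , y , z) = x * n + y * (3 * n ∸ 2) + z * (3 * n ∸ 1)

InT : ℕ → ℕ → Set
InT n s = ∃[ v ] ev n v ≡ s

-- F is the Frobenius number of T: F ∉ T and every integer > F lies in T
-- (negative integers are never in T)
IsFrobT : ℕ → ℕ → Set
IsFrobT n F = ¬ InT n F × (∀ m → F < m → InT n m)

InS : ℕ → ℕ → ℕ → Set
InS n F s = InT n s ⊎ s ≡ F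

-- Apéry set Ap(S, m) = { s ∈ S : s - m ∉ S } (s - m < 0 is never in S)
InAp : ℕ → ℕ → ℕ → ℕ → Set
InAp n F m s = InS n F s × (m ≤ s → ¬ InS n F (s ∸ m))

_≤³_ : ℕ³ → ℕ³ → Set
(a , b , c) ≤³ (x , y , z) = a ≤ x × b ≤ y × c ≤ z

record IsLShape (n F : ℕ) (L : ℕ³ → Set) : Set where
  field
    mapsInto   : ∀ u → L u → InAp n F F (ev n u)
    injective  : ∀ u v → L u → L v → ev n u ≡ ev n v → u ≡ v
    surjective : ∀ s → InAp n F F s → ∃[ u ] (L u × ev n u ≡ s)
    downClosed : ∀ u v → L u → v ≤³ u → L v

-- Since 3n - 2 and 3n - 1 fall short of 3n by 2 and 1, every factorization (x, y, z)
-- satisfies  ev (x, y, z) + (2y + z) = (x + 3y + 3z) n.  Comparing with the factorization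
-- (p, i - 2, 1) of sᵢ, whose deficit 2i - 3 is below n, forces  2y + z = 2i - 3 + e n  and
-- x + 3y + 3z = p + 3i - 3 + e  for some e.  For e ≥ 1 the second equation leaves no room
-- except e = 1, x = z = 0.  For e = 0, z is odd and x = 3y + 3((n-1)/2 - i) + 5 ≥ 3; z = 1
-- and y = 0 give the other two points, while y ≥ 1, z ≥ 3 would put (0,0,2) and (3,1,0),
-- both of value 6n - 2, into L.
module Submission where

open import Defs
open import Data.Nat using (ℕ; zero; suc; _+_; _*_; _∸_; _≤_; _<_; _/_; _%_; s≤s; z≤n)
open import Data.Nat.Properties
open import Data.Nat.DivMod using (m≡m%n+[m/n]*n; m*n/n≡m)
open import Data.Nat.Tactic.RingSolver using (solve)
open import Data.List using ([]; _∷_)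
open import Data.Product using (_×_; _,_; ∃-syntax)
open import Data.Sum using (_⊎_; inj₁; inj₂)
open import Data.Empty using (⊥-elim)
open import Relation.Nullary using (¬_; yes; no)
open import Relation.Binary.PropositionalEquality
  using (_≡_; refl; sym; trans; cong; cong₂; subst; module ≡-Reasoning)

weight deficit : ℕ³ → ℕ
weight (x , y , z) = x + 3 * y + 3 * z
deficit (x , y , z) = 2 * y + z

ev-suc : ∀ k x y z → ev (suc k) (x , y , z) ≡ x * suc k + y * (1 + 3 * k) + z * (2 + 3 * k)
ev-suc k x y z =
  cong (λ m → x * suc k + y * (m ∸ 2) + z * (m ∸ 1)) (*-suc 3 k)

ev+deficit≡weight*n : ∀ k v → ev (suc k) v + deficit v ≡ weight v * suc k
ev+deficit≡weight*n k (x , y , z) = begin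
  ev (suc k) (x , y , z) + (2 * y + z)
    ≡⟨ cong (_+ (2 * y + z)) (ev-suc k x y z) ⟩
  x * suc k + y * (1 + 3 * k) + z * (2 + 3 * k) + (2 * y + z)
    ≡⟨ solve (k ∷ x ∷ y ∷ z ∷ []) ⟩
  (x + 3 * y + 3 * z) * suc k ∎
  where open ≡-Reasoning

ev[0,0,2]≡ev[3,1,0] : ∀ n → ev n (0 , 0 , 2) ≡ ev n (3 , 1 , 0)
ev[0,0,2]≡ev[3,1,0] zero = refl
ev[0,0,2]≡ev[3,1,0] (suc k) = begin
  ev (suc k) (0 , 0 , 2)                        ≡⟨ ev-suc k 0 0 2 ⟩
  0 * suc k + 0 * (1 + 3 * k) + 2 * (2 + 3 * k) ≡⟨ solve (k ∷ []) ⟩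
  3 * suc k + 1 * (1 + 3 * k) + 0 * (2 + 3 * k) ≡⟨ sym (ev-suc k 3 1 0) ⟩
  ev (suc k) (3 , 1 , 0)                        ∎
  where open ≡-Reasoning

¬L-above-[3,1,2] : ∀ {n F L} → IsLShape n F L → ∀ u → L u → ¬ ((3 , 1 , 2) ≤³ u)
¬L-above-[3,1,2] {n} lShape (x , y , z) u∈L (3≤x , 1≤y , 2≤z)
  with injective _ _ (downClosed _ _ u∈L (z≤n , z≤n , 2≤z))
                     (downClosed _ _ u∈L (3≤x , 1≤y , z≤n))
                     (ev[0,0,2]≡ev[3,1,0] n)
  where open IsLShape lShape
... | ()

*+<-shift : ∀ {n r t a b} → r < n → a * n + r ≡ b * n + t → ∃[ e ] a ≡ b + e × t ≡ r + e * n
*+<-shift {n} {r} {t} {a} {b} r<n eq with b ≤? a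
... | yes b≤a with m≤n⇒∃[o]m+o≡n b≤a
...   | e , refl = e , refl , +-cancelˡ-≡ (b * n) t (r + e * n) (begin
  b * n + t        ≡⟨ sym eq ⟩
  (b + e) * n + r  ≡⟨ solve (n ∷ r ∷ b ∷ e ∷ []) ⟩
  b * n + (r + e * n) ∎)
  where open ≡-Reasoning
*+<-shift {n} {r} {t} {a} {b} r<n eq | no b≰a = ⊥-elim (<-irrefl refl (begin-strict
  a * n + r     <⟨ +-monoʳ-< (a * n) r<n ⟩
  a * n + n     ≡⟨ +-comm (a * n) n ⟩
  suc a * n     ≤⟨ *-monoˡ-≤ n (≰⇒> b≰a) ⟩
  b * n         ≤⟨ m≤m+n (b * n) t ⟩
  b * n + t     ≡⟨ sym eq ⟩
  a * n + r     ∎))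
  where open ≤-Reasoning

odd⇒n≡1+[n/2]*2 : ∀ n → n % 2 ≡ 1 → n ≡ 1 + n / 2 * 2
odd⇒n≡1+[n/2]*2 n odd = trans (m≡m%n+[m/n]*n n 2) (cong (_+ n / 2 * 2) odd)

odd-parametrisation : ∀ n i → n % 2 ≡ 1 → 2 ≤ i → i ≤ (n ∸ 1) / 2 →
                      ∃[ j ] ∃[ d ] i ≡ 2 + j × n ≡ 5 + 2 * (j + d)
odd-parametrisation n i odd 2≤i i≤[n∸1]/2
  with m≤n⇒∃[o]m+o≡n 2≤i | m≤n⇒∃[o]m+o≡n (subst (i ≤_) [n∸1]/2≡n/2 i≤[n∸1]/2)
  where
    [n∸1]/2≡n/2 : (n ∸ 1) / 2 ≡ n / 2
    [n∸1]/2≡n/2 = trans (cong (λ m → (m ∸ 1) / 2) (odd⇒n≡1+[n/2]*2 n odd)) (m*n/n≡m (n / 2) 2)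
... | j , refl | d , i+d≡n/2 = j , d , refl , (begin
  n                    ≡⟨ odd⇒n≡1+[n/2]*2 n odd ⟩
  1 + n / 2 * 2        ≡⟨ cong (λ m → 1 + m * 2) i+d≡n/2 ⟨
  1 + (2 + j + d) * 2  ≡⟨ solve (j ∷ d ∷ []) ⟩
  5 + 2 * (j + d)      ∎)
  where open ≡-Reasoning

-- j = i - 2 and d = (n - 1)/2 - i, so that p = (3n - 5)/2.
module Classification (j d : ℕ) where

  n p : ℕ
  n = 5 + 2 * (j + d)
  p = 3 * j + 3 * d + 5

  Candidate : ℕ³ → Set
  Candidate v = v ≡ (p , j , 1) ⊎ v ≡ (0 , 2 * j + d + 3 , 0) ⊎ v ≡ (3 * d + 5 , 0 , 2 * j + 1)

  [3n∸5]/2≡p : (3 * n ∸ 5) / 2 ≡ p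
  [3n∸5]/2≡p = begin
    (3 * n ∸ 5) / 2       ≡⟨ cong (λ m → (m ∸ 5) / 2) 3n≡5+p*2 ⟩
    (5 + p * 2 ∸ 5) / 2   ≡⟨ cong (_/ 2) (m+n∸m≡n 5 (p * 2)) ⟩
    p * 2 / 2             ≡⟨ m*n/n≡m p 2 ⟩
    p                     ∎
    where
      open ≡-Reasoning
      3n≡5+p*2 : 3 * (5 + 2 * (j + d)) ≡ 5 + (3 * j + 3 * d + 5) * 2
      3n≡5+p*2 = solve (j ∷ d ∷ [])

  [n∸3]/2+i≡ : (n ∸ 3) / 2 + (2 + j) ≡ 2 * j + d + 3
  [n∸3]/2+i≡ = begin
    (2 + 2 * (j + d)) / 2 + (2 + j)   ≡⟨ cong (λ m → m / 2 + (2 + j)) 2+2[j+d]≡[1+j+d]*2 ⟩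
    (1 + j + d) * 2 / 2 + (2 + j)     ≡⟨ cong (_+ (2 + j)) (m*n/n≡m (1 + j + d) 2) ⟩
    1 + j + d + (2 + j)               ≡⟨ solve (j ∷ d ∷ []) ⟩
    2 * j + d + 3                     ∎
    where
      open ≡-Reasoning
      2+2[j+d]≡[1+j+d]*2 : 2 + 2 * (j + d) ≡ (1 + j + d) * 2
      2+2[j+d]≡[1+j+d]*2 = solve (j ∷ d ∷ [])

  p∸3j≡3d+5 : p ∸ 3 * j ≡ 3 * d + 5
  p∸3j≡3d+5 = trans (cong (_∸ 3 * j) (+-assoc (3 * j) (3 * d) 5)) (m+n∸m≡n (3 * j) (3 * d + 5))

  ev[p,j,1]≡ : p * n + j * (3 * n ∸ 2) + (3 * n ∸ 1) ≡ ev n (p , j , 1)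
  ev[p,j,1]≡ = cong (p * n + j * (3 * n ∸ 2) +_) (sym (*-identityˡ (3 * n ∸ 1)))

  deficit-small : deficit (p , j , 1) < n
  deficit-small = begin-strict
    2 * j + 1                 <⟨ m<m+n (2 * j + 1) (s≤s z≤n) ⟩
    2 * j + 1 + (4 + 2 * d)   ≡⟨ solve (j ∷ d ∷ []) ⟩
    5 + 2 * (j + d)           ∎
    where open ≤-Reasoning

  x-on-level : ∀ x y z → 2 * y + z ≡ 2 * j + 1 → weight (x , y , z) ≡ weight (p , j , 1) →
               x ≡ 3 * y + 3 * d + 5
  x-on-level x y z deficit≡ weight≡ = +-cancelʳ-≡ (3 * (2 * j + 1)) x (3 * y + 3 * d + 5) (begin
    x + 3 * (2 * j + 1)                     ≡⟨ cong (λ t → x + 3 * t) (sym deficit≡) ⟩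
    x + 3 * (2 * y + z)                     ≡⟨ solve (x ∷ y ∷ z ∷ []) ⟩
    x + 3 * y + 3 * z + 3 * y               ≡⟨ cong (_+ 3 * y) weight≡ ⟩
    3 * j + 3 * d + 5 + 3 * j + 3 * 1 + 3 * y ≡⟨ solve (j ∷ d ∷ y ∷ []) ⟩
    3 * y + 3 * d + 5 + 3 * (2 * j + 1)     ∎)
    where open ≡-Reasoning

  on-level : ∀ {F L} → IsLShape n F L → ∀ x y z → L (x , y , z) →
             2 * y + z ≡ 2 * j + 1 → weight (x , y , z) ≡ weight (p , j , 1) → Candidate (x , y , z)
  on-level lShape x y z v∈L deficit≡ weight≡ with x-on-level x y z deficit≡ weight≡
  on-level lShape _ zero z v∈L refl weight≡ | refl = inj₂ (inj₂ refl)
  on-level lShape _ (suc y) zero v∈L deficit≡ weight≡ | refl =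
    ⊥-elim (even≢odd (suc y) j (trans (sym (+-identityʳ _)) (trans deficit≡ (+-comm (2 * j) 1))))
  on-level lShape _ (suc y) 1 v∈L deficit≡ weight≡ | refl =
    inj₁ (cong (λ w → (3 * w + 3 * d + 5 , w , 1)) (*-cancelˡ-≡ (suc y) j 2 (+-cancelʳ-≡ 1 _ _ deficit≡)))
  on-level lShape _ (suc y) (suc (suc z)) v∈L deficit≡ weight≡ | refl =
    ⊥-elim (¬L-above-[3,1,2] lShape _ v∈L (3≤x , s≤s z≤n , s≤s (s≤s z≤n)))
    where
      3≤x : 3 ≤ 3 * suc y + 3 * d + 5
      3≤x = ≤-trans (m≤m+n 3 2) (m≤n+m 5 (3 * suc y + 3 * d))

  above-level : ∀ x y z e → 2 * y + z ≡ 2 * j + 1 + suc e * n →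
                weight (x , y , z) ≡ weight (p , j , 1) + suc e →
                (x , y , z) ≡ (0 , 2 * j + d + 3 , 0)
  above-level x y z e deficit≡ weight≡ = cong₂ _,_ x≡0 (cong₂ _,_ y≡ z≡0)
    where
      open ≡-Reasoning
      c : ℕ
      c = 2 * (3 * j + 3 * d + 5 + 3 * j + 3 * 1 + suc e)
      excess≡0 : e * (13 + 6 * (j + d)) + 2 * x + 3 * z ≡ 0
      excess≡0 = +-cancelˡ-≡ c _ 0 (begin
        2 * (3 * j + 3 * d + 5 + 3 * j + 3 * 1 + suc e) + (e * (13 + 6 * (j + d)) + 2 * x + 3 * z)
          ≡⟨ solve (j ∷ d ∷ e ∷ x ∷ z ∷ []) ⟩
        3 * (2 * j + 1 + suc e * (5 + 2 * (j + d))) + (2 * x + 3 * z)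
          ≡⟨ cong (λ t → 3 * t + (2 * x + 3 * z)) (sym deficit≡) ⟩
        3 * (2 * y + z) + (2 * x + 3 * z)
          ≡⟨ solve (x ∷ y ∷ z ∷ []) ⟩
        2 * (x + 3 * y + 3 * z)
          ≡⟨ cong (2 *_) weight≡ ⟩
        c
          ≡⟨ +-identityʳ c ⟨
        c + 0 ∎)
      ex+2x≡0 : e * (13 + 6 * (j + d)) + 2 * x ≡ 0
      ex+2x≡0 = m+n≡0⇒m≡0 (e * (13 + 6 * (j + d)) + 2 * x) excess≡0
      e≡0 : e ≡ 0
      e≡0 = m*n≡0⇒m≡0 e (13 + 6 * (j + d)) (m+n≡0⇒m≡0 (e * (13 + 6 * (j + d))) ex+2x≡0)
      x≡0 : x ≡ 0
      x≡0 = *-cancelˡ-≡ x 0 2 (m+n≡0⇒n≡0 (e * (13 + 6 * (j + d))) ex+2x≡0)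
      z≡0 : z ≡ 0
      z≡0 = *-cancelˡ-≡ z 0 3 (m+n≡0⇒n≡0 (e * (13 + 6 * (j + d)) + 2 * x) excess≡0)
      y≡ : y ≡ 2 * j + d + 3
      y≡ = *-cancelˡ-≡ y (2 * j + d + 3) 2 (begin
        2 * y                                      ≡⟨ +-identityʳ (2 * y) ⟨
        2 * y + 0                                  ≡⟨ cong (2 * y +_) z≡0 ⟨
        2 * y + z                                  ≡⟨ deficit≡ ⟩
        2 * j + 1 + suc e * (5 + 2 * (j + d))      ≡⟨ cong (λ t → 2 * j + 1 + suc t * (5 + 2 * (j + d))) e≡0 ⟩
        2 * j + 1 + 1 * (5 + 2 * (j + d))          ≡⟨ solve (j ∷ d ∷ []) ⟩
        2 * (2 * j + d + 3)                        ∎)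

  classify : ∀ {F L} → IsLShape n F L → ∀ x y z → L (x , y , z) →
             ev n (x , y , z) ≡ ev n (p , j , 1) → Candidate (x , y , z)
  classify lShape x y z v∈L ev≡ with *+<-shift deficit-small levels
    where
      open ≡-Reasoning
      v u : ℕ³
      v = (x , y , z)
      u = (p , j , 1)
      k : ℕ
      k = 4 + 2 * (j + d)
      levels : weight v * n + deficit u ≡ weight u * n + deficit v
      levels = begin
        weight v * n + deficit u           ≡⟨ cong (_+ deficit u) (ev+deficit≡weight*n k v) ⟨
        ev n v + deficit v + deficit u     ≡⟨ +-assoc (ev n v) _ _ ⟩
        ev n v + (deficit v + deficit u)   ≡⟨ cong₂ _+_ ev≡ (+-comm (deficit v) _) ⟩
        ev n u + (deficit u + deficit v)   ≡⟨ +-assoc (ev n u) _ _ ⟨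
        ev n u + deficit u + deficit v     ≡⟨ cong (_+ deficit v) (ev+deficit≡weight*n k u) ⟩
        weight u * n + deficit v           ∎
  ... | zero , weight≡ , deficit≡ =
    on-level lShape x y z v∈L (trans deficit≡ (+-identityʳ _)) (trans weight≡ (+-identityʳ _))
  ... | suc e , weight≡ , deficit≡ = inj₂ (inj₁ (above-level x y z e deficit≡ weight≡))

open Classification using (classify; ev[p,j,1]≡; [3n∸5]/2≡p; [n∸3]/2+i≡; p∸3j≡3d+5)

mainTheorem13 : (n : ℕ) → 5 ≤ n → n % 2 ≡ 1 →
    (F : ℕ) → IsFrobT n F →
    (L : ℕ³ → Set) → IsLShape n F L →
    (i : ℕ) → 3 ≤ i → i ≤ (n ∸ 1) / 2 →
    (x y z : ℕ) → L (x , y , z) →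
    ev n (x , y , z) ≡ ((3 * n ∸ 5) / 2) * n + (i ∸ 2) * (3 * n ∸ 2) + (3 * n ∸ 1) →
    ((x , y , z) ≡ ((3 * n ∸ 5) / 2 , i ∸ 2 , 1))
    ⊎ ((x , y , z) ≡ (0 , (n ∸ 3) / 2 + i , 0))
    ⊎ ((x , y , z) ≡ ((3 * n ∸ 5) / 2 ∸ 3 * (i ∸ 2) , 0 , 2 * (i ∸ 2) + 1))
mainTheorem13 n _ odd _ _ _ lShape i 3≤i i≤[n∸1]/2 x y z v∈L ev≡
  with odd-parametrisation n i odd (≤-trans (n≤1+n 2) 3≤i) i≤[n∸1]/2
... | j , d , refl , refl
  rewrite [3n∸5]/2≡p j d | [n∸3]/2+i≡ j d | p∸3j≡3d+5 j d =
  classify j d lShape x y z v∈L (trans ev≡ (ev[p,j,1]≡ j d))
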